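{- Let $\ell\ge3$, let $\lambda$ be an $(\ell,0)$-JM partition, $0\le i<\ell$, and put $\widehat\varphi=\widehat\varphi_i(\lambda)$, $\widehat\varepsilon=\widehat\varepsilon_i(\lambda)$. Then (1) $\widehat f_i^{k}\lambda$ is not an $(\ell,0)$-JM partition for $0<k<\widehat\varphi-1$; (2) $\widehat e_i^{k}\lambda$ is not an $(\ell,0)$-JM partition for $1<k<\widehat\varepsilon$.
   Context: Young diagrams in English notation; $(a,b)$ is the box in row $a$, column $b$, residue $b-a\bmod\ell$. Hook length $h^\lambda_{(a,b)}$: number of boxes of $\lambda$ in row $a$ weakly right of $(a,b)$ plus those in column $b$ strictly below. $\lambda$ is an $(\ell,0)$-JM partition if there are no boxes $(a,b),(a,y),(x,b)$ of $\lambda$ with $\ell\mid h^\lambda_{(a,b)}$, $\ell\nmid h^\lambda_{(a,y)}$, $\ell\nmid h^\lambda_{(x,b)}$. Removable (resp. addable) $i$-box: a box in $\lambda$ (resp. position not in $\lambda$) of residue $i$ whose removal (resp. addition) yields a partition. The ladder of $(a,b)$ is the set of positions $(c,d)$, $c,d\ge1$, with $c+(\ell-1)d=a+(\ell-1)b$; ladders are ordered left to right by increasing $c+(\ell-1)d$, within a ladder top to bottom by increasing row index. Ladder crystal: the ladder $i$-signature of $\lambda$ writes $+$ for each addable $i$-box and $-$ for each removable $i$-box, reading ladders left to right and each ladder top to bottom; repeatedly deleting adjacent "$-+$" gives $+\cdots+-\cdots-$. Remaining $-$'s are ladder normal $i$-boxes (leftmost: ladder good), remaining $+$'s ladder conormal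 (rightmost: ladder cogood). $\widehat f_i\lambda$ adds the ladder cogood $i$-box, $\widehat e_i\lambda$ removes the ladder good $i$-box ($0$ if none); $\widehat\varphi_i(\lambda)$, $\widehat\varepsilon_i(\lambda)$ are the numbers of ladder conormal, ladder normal $i$-boxes. -}

module Defs where

open import Data.Nat using (ℕ; zero; suc; _+_; _*_; _∸_; _≤_; _<_; _%_; _<ᵇ_; _≡ᵇ_)
open import Data.Nat.Divisibility using (_∣_)
open import Data.Bool using (Bool; true; false; if_then_else_; _∧_; _∨_; not)
open import Data.List using (List; []; _∷_; length; filter; reverse; foldl; _++_; map; upTo; concatMap)
open import Data.List.Relation.Unary.All using (All)
open import Data.List.Relation.Unary.Linked using (Linked)
open import Data.Maybe using (Maybe; just; nothing; _>>=_)
open import Data.Product using (Σ; _×_; _,_)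
open import Data.Empty using (⊥)
open import Relation.Nullary using (¬_)
open import Relation.Binary.PropositionalEquality using (_≡_)
open import Data.Nat using (_≥_)

-- Partitions: list of row lengths (row 1 first), weakly decreasing, positive.

IsPartition : List ℕ → Set
IsPartition p = Linked _≥_ p × All (λ x → 0 < x) p

-- length of row a (rows are 1-indexed); 0 outside the diagram
row : List ℕ → ℕ → ℕ
row []       _             = 0
row (x ∷ xs) zero          = 0
row (x ∷ xs) (suc zero)    = x
row (x ∷ xs) (suc (suc n)) = row xs (suc n)

colLen : List ℕ → ℕ → ℕ
colLen p b = length (filter (λ x → Data.Nat._≤?_ b x) p)

-- (a , b) is a box of the Young diagram (English notation)
Box : List ℕ → ℕ → ℕ → Set
Box p a b = (1 ≤ a) × (1 ≤ b) × (b ≤ row p a)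

hook : List ℕ → ℕ → ℕ → ℕ
hook p a b = (row p a ∸ b) + 1 + (colLen p b ∸ a)

IsJM : ℕ → List ℕ → Set
IsJM ℓ p = ¬ (Σ ℕ λ a → Σ ℕ λ b → Σ ℕ λ y → Σ ℕ λ x →
               Box p a b × Box p a y × Box p x b ×
               ℓ ∣ hook p a b × ¬ (ℓ ∣ hook p a y) × ¬ (ℓ ∣ hook p x b))

-- the crystal operators return 0 (nothing) when undefined; 0 is not a JM partition
IsJMᵐ : ℕ → Maybe (List ℕ) → Set
IsJMᵐ ℓ nothing  = ⊥
IsJMᵐ ℓ (just p) = IsJM ℓ p

_mod_ : ℕ → ℕ → ℕ
m mod zero  = m
m mod suc n = m % suc n

-- residue of (a,b) is (b - a) mod ℓ, computed as (b + (ℓ-1)a) mod ℓ (a ≥ 1)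
res : ℕ → ℕ → ℕ → ℕ
res ℓ a b = (b + (ℓ ∸ 1) * a) mod ℓ

data Sign : Set where
  plus minus : Sign

-- a signed node: sign, row, column
Node : Set
Node = Sign × ℕ × ℕ

rows : ℕ → List ℕ
rows n = map suc (upTo n)

addables : List ℕ → List Node
addables p = concatMap f (rows (suc (length p)))
  where
  f : ℕ → List Node
  f a = if (a ≡ᵇ 1) ∨ (row p a <ᵇ row p (a ∸ 1))
        then (plus , a , suc (row p a)) ∷ [] else []

removables : List ℕ → List Node
removables p = concatMap f (rows (length p))
  where
  f : ℕ → List Node
  f a = if row p (suc a) <ᵇ row p a
        then (minus , a , row p a) ∷ [] else []

iNodes : ℕ → ℕ → List ℕ → List Node
iNodes ℓ i p = filter (λ { (_ , a , b) → Data.Nat._≟_ (res ℓ a b) i })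
                      (addables p ++ removables p)

ladderLt : ℕ → Node → Node → Bool
ladderLt ℓ (_ , a , b) (_ , c , d) =
  let L₁ = a + (ℓ ∸ 1) * b ; L₂ = c + (ℓ ∸ 1) * d in
  (L₁ <ᵇ L₂) ∨ ((L₁ ≡ᵇ L₂) ∧ (a <ᵇ c))

insert : ℕ → Node → List Node → List Node
insert ℓ n []       = n ∷ []
insert ℓ n (m ∷ ms) = if ladderLt ℓ n m then n ∷ m ∷ ms else m ∷ insert ℓ n ms

sortLadder : ℕ → List Node → List Node
sortLadder ℓ []       = []
sortLadder ℓ (n ∷ ns) = insert ℓ n (sortLadder ℓ ns)

signature : ℕ → ℕ → List ℕ → List Node
signature ℓ i p = sortLadder ℓ (iNodes ℓ i p)

-- cancellation of adjacent "-+" pairs (stack-based; acc is reversed)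
step : List Node → Node → List Node
step ((minus , m) ∷ acc) (plus , n) = acc
step acc n = n ∷ acc

reduced : ℕ → ℕ → List ℕ → List Node
reduced ℓ i p = reverse (foldl step [] (signature ℓ i p))

isPlus : Node → Bool
isPlus (plus , _)  = true
isPlus (minus , _) = false

conormals : ℕ → ℕ → List ℕ → List Node
conormals ℓ i p = filter (λ n → Data.Bool._≟_ (isPlus n) true) (reduced ℓ i p)

normals : ℕ → ℕ → List ℕ → List Node
normals ℓ i p = filter (λ n → Data.Bool._≟_ (isPlus n) false) (reduced ℓ i p)

φ̂ : ℕ → ℕ → List ℕ → ℕ
φ̂ ℓ i p = length (conormals ℓ i p)

ε̂ : ℕ → ℕ → List ℕ → ℕ
ε̂ ℓ i p = length (normals ℓ i p)

firstM : List Node → Maybe Node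
firstM []      = nothing
firstM (n ∷ _) = just n

lastM : List Node → Maybe Node
lastM []       = nothing
lastM (n ∷ []) = just n
lastM (_ ∷ m ∷ ms) = lastM (m ∷ ms)

addAt : List ℕ → ℕ → List ℕ
addAt []       _             = 1 ∷ []
addAt (x ∷ xs) zero          = x ∷ xs
addAt (x ∷ xs) (suc zero)    = suc x ∷ xs
addAt (x ∷ xs) (suc (suc n)) = x ∷ addAt xs (suc n)

removeAt : List ℕ → ℕ → List ℕ
removeAt []       _             = []
removeAt (x ∷ xs) zero          = x ∷ xs
removeAt (x ∷ xs) (suc zero)    = if x ≡ᵇ 1 then xs else (x ∸ 1) ∷ xs
removeAt (x ∷ xs) (suc (suc n)) = x ∷ removeAt xs (suc n)

f̂ : ℕ → ℕ → List ℕ → Maybe (List ℕ)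
f̂ ℓ i p with lastM (conormals ℓ i p)
... | nothing          = nothing
... | just (_ , a , _) = just (addAt p a)

ê : ℕ → ℕ → List ℕ → Maybe (List ℕ)
ê ℓ i p with firstM (normals ℓ i p)
... | nothing          = nothing
... | just (_ , a , _) = just (removeAt p a)

iter : (List ℕ → Maybe (List ℕ)) → ℕ → List ℕ → Maybe (List ℕ)
iter g zero    p = just p
iter g (suc k) p = iter g k p >>= g

module Submission where

-- Everything rests on one obstruction: a partition with two addable i-boxes and a removable
-- i-box is never JM.  Since ℓ divides the hook of (a,b) iff the position right of row a and the
-- bottom box of column b have equal residues, the three i-boxes always produce a box with
-- divisible hook whose arm end and leg end have indivisible hooks.  The rest is counting: φ̂ and
-- ε̂ are at most the numbers of addable and removable i-boxes (reducing the ladder signature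
-- only deletes nodes of a permutation of the i-nodes); an f̂-step loses at most one addable and
-- creates a removable i-box, an ê-step creates an addable and loses at most one removable one.

open import Defs
open import Data.Nat using (ℕ; zero; suc; _+_; _*_; _∸_; _≤_; _<_; _≥_; _%_; _/_; z≤n; s≤s; _≤′_; ≤′-refl; ≤′-step; NonZero; _≟_; _≡ᵇ_; _<ᵇ_)
open import Data.Nat.Properties
open import Data.Nat.DivMod using (m≡m%n+[m/n]*n; %-remove-+ˡ; %-remove-+ʳ)
open import Data.Nat.Divisibility using (_∣_; divides; ∣m+n∣m⇒∣n; m∣m*n; n∣m*n; ∣1⇒≡1; ∣⇒≤)
open import Data.Nat.Tactic.RingSolver using (solve-∀)
open import Data.Bool using (Bool; true; false; T; _∧_; _∨_; if_then_else_)
open import Data.Bool.Properties using (T-∧; ∧-zeroʳ; ∧-identityʳ) renaming (_≟_ to _≟ᵇ_)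
open import Data.Unit using (tt)
open import Data.List using (List; []; _∷_; _++_; length; filter; concatMap; foldl; _ʳ++_; map; upTo)
open import Data.List.Properties using (filter-accept; filter-reject; length-++; filter-++; concatMap-++; ++-identityʳ; map-++; upTo-∷ʳ; reverse-involutive)
open import Data.List.Relation.Unary.All using (All; []; _∷_)
open import Data.List.Relation.Unary.Linked using (Linked; []; [-]; _∷_; tail)
open import Data.List.Relation.Unary.Any using (here; there; satisfied)
open import Data.List.Membership.Propositional using (_∈_)
open import Data.List.Membership.Propositional.Properties using (∈-filter⁻; ∈-++⁻; ∈-concatMap⁻)
import Data.List.Relation.Binary.Permutation.Propositional as ↭
open import Data.List.Relation.Binary.Permutation.Propositional using (_↭_)
open import Data.List.Relation.Binary.Permutation.Propositional.Properties using (↭-length; filter-↭; ∈-resp-↭)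
open import Data.List.Relation.Binary.Sublist.Propositional using (_⊆_; _∷ʳ_; ⊆-refl; ⊆-trans; lookup)
open import Data.List.Relation.Binary.Sublist.Propositional.Properties using (filter⁺; reverse⁺; ʳ++⁺)
open import Data.List.Relation.Binary.Sublist.Heterogeneous.Properties using (length-mono-≤)
open import Data.Maybe using (just)
open import Data.Product using (∃; ∃₂; _×_; _,_; proj₁; proj₂)
open import Data.Sum using (_⊎_; inj₁; inj₂) renaming (map to ⊎-map)
open import Data.Empty using (⊥-elim)
open import Function using (_∘_)
open import Function.Bundles using (_⇔_; mk⇔; Equivalence)
open import Relation.Nullary using (¬_; does; yes; no)
open import Relation.Unary using (Decidable)
open import Relation.Binary using (tri<; tri≈; tri>)
open import Relation.Binary.PropositionalEquality

module _ {ℓ : ℕ} .{{_ : NonZero ℓ}} (h X Y k : ℕ) (balance : h + Y ≡ X + ℓ * k) where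
  open ≡-Reasoning

  ∣⇒congruent : ℓ ∣ h → X % ℓ ≡ Y % ℓ
  ∣⇒congruent ℓ∣h = begin
    X % ℓ            ≡⟨ %-remove-+ʳ X (m∣m*n k) ⟨
    (X + ℓ * k) % ℓ  ≡⟨ cong (_% ℓ) balance ⟨
    (h + Y) % ℓ      ≡⟨ %-remove-+ˡ Y ℓ∣h ⟩
    Y % ℓ            ∎

  congruent⇒∣ : X % ℓ ≡ Y % ℓ → ℓ ∣ h
  congruent⇒∣ X≡Y = ∣m+n∣m⇒∣n (divides (X / ℓ + k) (+-cancelʳ-≡ t _ _ shifted)) (n∣m*n (Y / ℓ))
    where
    t : ℕ
    t = Y % ℓ
    rearrangeˡ : ∀ h t q ℓ → (q * ℓ + h) + t ≡ h + (t + q * ℓ)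
    rearrangeˡ = solve-∀
    rearrangeʳ : ∀ t q k ℓ → (t + q * ℓ) + ℓ * k ≡ (q + k) * ℓ + t
    rearrangeʳ = solve-∀
    -- write X and Y through their common remainder t
    shifted : (Y / ℓ * ℓ + h) + t ≡ (X / ℓ + k) * ℓ + t
    shifted = begin
      (Y / ℓ * ℓ + h) + t    ≡⟨ rearrangeˡ h t (Y / ℓ) ℓ ⟩
      h + (t + Y / ℓ * ℓ)    ≡⟨ cong (h +_) (m≡m%n+[m/n]*n Y ℓ) ⟨
      h + Y                  ≡⟨ balance ⟩
      X + ℓ * k              ≡⟨ cong (_+ ℓ * k) (trans (m≡m%n+[m/n]*n X ℓ) (cong (_+ X / ℓ * ℓ) X≡Y)) ⟩
      (t + X / ℓ * ℓ) + ℓ * k ≡⟨ rearrangeʳ t (X / ℓ) k ℓ ⟩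
      (X / ℓ + k) * ℓ + t    ∎

-- Rows and columns of a partition.

row-zero : ∀ p → row p 0 ≡ 0
row-zero []      = refl
row-zero (_ ∷ _) = refl

row-beyond : ∀ p {a} → length p < a → row p a ≡ 0
row-beyond []       _                = refl
row-beyond (_ ∷ _)  {suc zero}    (s≤s ())
row-beyond (_ ∷ xs) {suc (suc a)} (s≤s len<a) = row-beyond xs len<a

row-step : ∀ {p} → Linked _≥_ p → ∀ c → row p (2 + c) ≤ row p (1 + c)
row-step {[]}         _           _       = z≤n
row-step {_ ∷ []}     _           _       = z≤n
row-step {_ ∷ _ ∷ _}  (x≥y ∷ _)   zero    = x≥y
row-step {_ ∷ _ ∷ _}  (_ ∷ l)     (suc c) = row-step l c

row-antitone : ∀ {p a c} → Linked _≥_ p → 1 ≤ a → a ≤ c → row p c ≤ row p a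
row-antitone {p} {a} l a≥1 a≤c = go (≤⇒≤′ a≤c)
  where
  go : ∀ {c} → a ≤′ c → row p c ≤ row p a
  go ≤′-refl                   = ≤-refl
  go (≤′-step {zero} a≤′0)     = ⊥-elim (<⇒≱ a≥1 (≤′⇒≤ a≤′0))
  go (≤′-step {suc c} a≤′1+c)  = ≤-trans (row-step l c) (go a≤′1+c)

previous-row : ∀ {a} → 2 ≤ a → 1 ≤ a ∸ 1 × a ∸ 1 ≢ a
previous-row {suc zero}    (s≤s ())
previous-row {suc (suc _)} _ = s≤s z≤n , λ eq → <-irrefl eq (n<1+n _)

colLen-exact : ∀ {p b} r → Linked _≥_ p → (∀ a → 1 ≤ a → a ≤ r → b ≤ row p a) →
               row p (suc r) < b → colLen p b ≡ r
colLen-exact {[]}     zero    _ _     _     = refl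
colLen-exact {[]}     (suc r) _ reach short = ⊥-elim (<⇒≱ short (reach 1 ≤-refl (s≤s z≤n)))
colLen-exact {x ∷ xs} {b} zero l _ x<b = begin
  colLen (x ∷ xs) b  ≡⟨ cong length (filter-reject (b ≤?_) (<⇒≱ x<b)) ⟩
  colLen xs b        ≡⟨ colLen-exact zero (tail l) (λ _ a≥1 a≤0 → ⊥-elim (<⇒≱ a≥1 a≤0))
                                          (≤-<-trans (row-step l 0) x<b) ⟩
  0                  ∎
  where
  open ≡-Reasoning
colLen-exact {x ∷ xs} {b} (suc r) l reach short = begin
  colLen (x ∷ xs) b  ≡⟨ cong length (filter-accept (b ≤?_) (reach 1 ≤-refl (s≤s z≤n))) ⟩
  suc (colLen xs b)  ≡⟨ cong suc (colLen-exact r (tail l) reach′ short) ⟩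
  suc r              ∎
  where
  open ≡-Reasoning
  reach′ : ∀ a → 1 ≤ a → a ≤ r → b ≤ row xs a
  reach′ (suc a) _ a≤r = reach (2 + a) (s≤s z≤n) (s≤s a≤r)

row-addAt-here : ∀ p {a} → 1 ≤ a → a ≤ suc (length p) → row (addAt p a) a ≡ suc (row p a)
row-addAt-here []      {suc zero}    _ _          = refl
row-addAt-here []      {suc (suc _)} _ (s≤s ())
row-addAt-here (_ ∷ _) {suc zero}    _ _          = refl
row-addAt-here (_ ∷ p) {suc (suc _)} _ (s≤s a≤)   = row-addAt-here p (s≤s z≤n) a≤

row-addAt-elsewhere : ∀ p {a₀} a → 1 ≤ a₀ → a₀ ≤ suc (length p) → a ≢ a₀ →
                      row (addAt p a₀) a ≡ row p a
row-addAt-elsewhere p zero _ _ _ = trans (row-zero (addAt p _)) (sym (row-zero p))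
row-addAt-elsewhere []      {suc zero}     (suc zero)    _ _ a≢a₀ = ⊥-elim (a≢a₀ refl)
row-addAt-elsewhere []      {suc zero}     (suc (suc _)) _ _ _    = refl
row-addAt-elsewhere []      {suc (suc _)}  (suc _)       _ (s≤s ()) _
row-addAt-elsewhere (_ ∷ _) {suc zero}     (suc zero)    _ _ a≢a₀ = ⊥-elim (a≢a₀ refl)
row-addAt-elsewhere (_ ∷ _) {suc zero}     (suc (suc _)) _ _ _    = refl
row-addAt-elsewhere (_ ∷ _) {suc (suc _)}  (suc zero)    _ _ _    = refl
row-addAt-elsewhere (_ ∷ p) {suc (suc _)}  (suc (suc a)) _ (s≤s a₀≤) a≢a₀ =
  row-addAt-elsewhere p (suc a) (s≤s z≤n) a₀≤ (λ a≡a₀ → a≢a₀ (cong suc a≡a₀))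

length-addAt : ∀ p a → length p ≤ length (addAt p a)
length-addAt []      _             = z≤n
length-addAt (_ ∷ _) zero          = ≤-refl
length-addAt (_ ∷ _) (suc zero)    = ≤-refl
length-addAt (_ ∷ p) (suc (suc a)) = s≤s (length-addAt p (suc a))

addAt-partition : ∀ p {a} → IsPartition p → 1 ≤ a → a ≤ suc (length p) →
                  (2 ≤ a → row p a < row p (a ∸ 1)) → IsPartition (addAt p a)
addAt-partition p (l , pos) a≥1 a≤ corner = decreasing p l pos a≥1 a≤ corner , positive p pos
  where
  lengthen-head : ∀ {y ys} → Linked _≥_ (y ∷ ys) → Linked _≥_ (suc y ∷ ys)
  lengthen-head [-]         = [-]
  lengthen-head (y≥z ∷ l)   = m≤n⇒m≤1+n y≥z ∷ l

  -- the corner condition is exactly what keeps the rows decreasing; a new row has length 1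
  decreasing : ∀ p {a} → Linked _≥_ p → All (0 <_) p → 1 ≤ a → a ≤ suc (length p) →
               (2 ≤ a → row p a < row p (a ∸ 1)) → Linked _≥_ (addAt p a)
  decreasing []           _          _         _ _ _ = [-]
  decreasing (_ ∷ _)      {suc zero} l _ _ _ _       = lengthen-head l
  decreasing (_ ∷ [])     {suc (suc zero)} _ (x>0 ∷ _) _ _ _ = x>0 ∷ [-]
  decreasing (_ ∷ [])     {suc (suc (suc _))} _ _ _ (s≤s (s≤s ())) _
  decreasing (_ ∷ _ ∷ _)  {suc (suc zero)} (_ ∷ l) _ _ _ corner = corner (s≤s (s≤s z≤n)) ∷ lengthen-head l
  decreasing (_ ∷ y ∷ ys) {suc (suc (suc _))} (x≥y ∷ l) (_ ∷ pos) _ (s≤s a≤) corner =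
    x≥y ∷ decreasing (y ∷ ys) l pos (s≤s z≤n) a≤ (λ _ → corner (s≤s (s≤s z≤n)))

  positive : ∀ p {a} → All (0 <_) p → All (0 <_) (addAt p a)
  positive []      _                       = s≤s z≤n ∷ []
  positive (_ ∷ _) {zero}        pos       = pos
  positive (_ ∷ _) {suc zero}    (_ ∷ pos) = s≤s z≤n ∷ pos
  positive (_ ∷ p) {suc (suc _)} (x>0 ∷ pos) = x>0 ∷ positive p pos

no-first-row : ∀ xs → All (0 <_) xs → row xs 1 < 1 → xs ≡ []
no-first-row []      _           _         = refl
no-first-row (_ ∷ _) (x>0 ∷ _)   (s≤s x≤0) = ⊥-elim (<⇒≱ x>0 x≤0)

row-removeAt-here : ∀ p {a} → All (0 <_) p → row p (suc a) < row p a →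
                    row (removeAt p a) a ≡ row p a ∸ 1
row-removeAt-here []                 {suc _}       _           ()
row-removeAt-here (zero ∷ _)         {suc zero}    (() ∷ _)    _
row-removeAt-here (suc zero ∷ xs)    {suc zero}    (_ ∷ pos)   short =
  cong (λ ys → row ys 1) (no-first-row xs pos short)
row-removeAt-here (suc (suc _) ∷ _)  {suc zero}    _           _     = refl
row-removeAt-here (_ ∷ p)            {suc (suc _)} (_ ∷ pos)   short = row-removeAt-here p pos short

row-removeAt-elsewhere : ∀ p {a₀} a → All (0 <_) p → row p (suc a₀) < row p a₀ → a ≢ a₀ →
                         row (removeAt p a₀) a ≡ row p a
row-removeAt-elsewhere p zero _ _ _ = trans (row-zero (removeAt p _)) (sym (row-zero p))
row-removeAt-elsewhere []  {suc _} (suc _) _ () _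
row-removeAt-elsewhere (_ ∷ _) {suc zero} (suc zero) _ _ a≢a₀ = ⊥-elim (a≢a₀ refl)
row-removeAt-elsewhere (zero ∷ _) {suc zero} (suc (suc _)) (() ∷ _) _ _
row-removeAt-elsewhere (suc zero ∷ xs) {suc zero} (suc (suc a)) (_ ∷ pos) short _
  rewrite no-first-row xs pos short = refl
row-removeAt-elsewhere (suc (suc _) ∷ _) {suc zero} (suc (suc _)) _ _ _ = refl
row-removeAt-elsewhere (_ ∷ _) {suc (suc _)} (suc zero) _ _ _ = refl
row-removeAt-elsewhere (_ ∷ p) {suc (suc _)} (suc (suc a)) (_ ∷ pos) short a≢a₀ =
  row-removeAt-elsewhere p (suc a) pos short (λ a≡a₀ → a≢a₀ (cong suc a≡a₀))

length-removeAt : ∀ p a → length (removeAt p a) ≤ length p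
length-removeAt []                _             = z≤n
length-removeAt (_ ∷ _)           zero          = ≤-refl
length-removeAt (zero ∷ _)        (suc zero)    = ≤-refl
length-removeAt (suc zero ∷ _)    (suc zero)    = n≤1+n _
length-removeAt (suc (suc _) ∷ _) (suc zero)    = ≤-refl
length-removeAt (_ ∷ p)           (suc (suc a)) = s≤s (length-removeAt p (suc a))

removeAt-partition : ∀ p {a} → IsPartition p → row p (suc a) < row p a → IsPartition (removeAt p a)
removeAt-partition p (l , pos) short = decreasing p l pos short , positive p pos
  where
  prepend : ∀ {x q} → row q 1 ≤ x → Linked _≥_ q → Linked _≥_ (x ∷ q)
  prepend {q = []}    _   _ = [-]
  prepend {q = _ ∷ _} y≤x l = y≤x ∷ l

  first-row-removeAt : ∀ p a → Linked _≥_ p → row (removeAt p a) 1 ≤ row p 1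
  first-row-removeAt []                _             _ = z≤n
  first-row-removeAt (_ ∷ _)           zero          _ = ≤-refl
  first-row-removeAt (zero ∷ _)        (suc zero)    _ = z≤n
  first-row-removeAt (suc zero ∷ _)    (suc zero)    l = row-step l 0
  first-row-removeAt (suc (suc _) ∷ _) (suc zero)    _ = n≤1+n _
  first-row-removeAt (_ ∷ _)           (suc (suc _)) _ = ≤-refl

  decreasing : ∀ p {a} → Linked _≥_ p → All (0 <_) p → row p (suc a) < row p a →
               Linked _≥_ (removeAt p a)
  decreasing []                 {suc _}       _ _ ()
  decreasing (zero ∷ _)         {suc zero}    _ (() ∷ _) _
  decreasing (suc zero ∷ _)     {suc zero}    l _ _           = tail l
  decreasing (suc (suc _) ∷ _)  {suc zero}    l _ (s≤s short) = prepend short (tail l)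
  decreasing (_ ∷ p)            {suc (suc a)} l (_ ∷ pos) short =
    prepend (≤-trans (first-row-removeAt p (suc a) (tail l)) (row-step l 0))
            (decreasing p (tail l) pos short)

  -- a row of length 1 disappears instead of becoming empty
  positive : ∀ p {a} → All (0 <_) p → All (0 <_) (removeAt p a)
  positive []                 _              = []
  positive (_ ∷ _)            {zero} pos     = pos
  positive (zero ∷ _)         {suc zero} (() ∷ _)
  positive (suc zero ∷ _)     {suc zero} (_ ∷ pos) = pos
  positive (suc (suc _) ∷ _)  {suc zero} (_ ∷ pos) = s≤s z≤n ∷ pos
  positive (_ ∷ p)            {suc (suc _)} (x>0 ∷ pos) = x>0 ∷ positive p pos

-- Counting the rows 1..N that satisfy a boolean test.

bit : Bool → ℕ
bit true  = 1
bit false = 0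

bit-mono : ∀ {b b′} → (T b → T b′) → bit b ≤ bit b′
bit-mono {false}          _ = z≤n
bit-mono {true} {true}    _ = ≤-refl
bit-mono {true} {false}   f = ⊥-elim (f tt)

count : (ℕ → Bool) → ℕ → ℕ
count P zero    = 0
count P (suc N) = count P N + bit (P (suc N))

count-none : ∀ N → count (λ _ → false) N ≡ 0
count-none zero    = refl
count-none (suc N) = trans (+-identityʳ _) (count-none N)

count-mono-range : ∀ P {M N} → M ≤ N → count P M ≤ count P N
count-mono-range P M≤N = go (≤⇒≤′ M≤N)
  where
  go : ∀ {M N} → M ≤′ N → count P M ≤ count P N
  go ≤′-refl      = ≤-refl
  go (≤′-step le) = ≤-trans (go le) (m≤m+n _ _)

count-stable : ∀ P {M N} → (∀ a → M < a → ¬ T (P a)) → M ≤ N → count P N ≡ count P M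
count-stable P {M} none M≤N = go (≤⇒≤′ M≤N)
  where
  go : ∀ {N} → M ≤′ N → count P N ≡ count P M
  go ≤′-refl = refl
  go (≤′-step {N} le) = begin
    count P N + bit (P (suc N)) ≡⟨ cong (count P N +_) (n≤0⇒n≡0 (bit-mono (none (suc N) (s≤s (≤′⇒≤ le))))) ⟩
    count P N + 0               ≡⟨ +-identityʳ _ ⟩
    count P N                   ≡⟨ go le ⟩
    count P M                   ∎
    where open ≡-Reasoning

count-mono : ∀ P Q N → (∀ a → a ≤ N → T (P a) → T (Q a)) → count P N ≤ count Q N
count-mono P Q zero    _   = z≤n
count-mono P Q (suc N) P⇒Q =
  +-mono-≤ (count-mono P Q N (λ a a≤N → P⇒Q a (m≤n⇒m≤1+n a≤N))) (bit-mono (P⇒Q (suc N) ≤-refl))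

count-mono-before : ∀ P Q N → (∀ a → a ≢ suc N → T (P a) → T (Q a)) → count P N ≤ count Q N
count-mono-before P Q N P⇒Q = count-mono P Q N (λ a a≤N → P⇒Q a (<⇒≢ (s≤s a≤N)))

count-except : ∀ P Q a₀ N → (∀ a → a ≢ a₀ → T (P a) → T (Q a)) → count P N ≤ suc (count Q N)
count-except P Q a₀ zero    _   = z≤n
count-except P Q a₀ (suc N) P⇒Q with suc N ≟ a₀
... | no  N+1≢a₀ = +-mono-≤ (count-except P Q a₀ N P⇒Q) (bit-mono (P⇒Q (suc N) N+1≢a₀))
... | yes refl   = begin
  count P N + bit (P (suc N))  ≤⟨ +-mono-≤ (count-mono-before P Q N P⇒Q) (bit-mono {b′ = true} (λ _ → tt)) ⟩
  count Q N + 1                ≡⟨ +-comm (count Q N) 1 ⟩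
  suc (count Q N)              ≤⟨ s≤s (m≤m+n _ _) ⟩
  suc (count Q N + bit (Q (suc N))) ∎
  where open ≤-Reasoning

count-gain : ∀ P Q a₀ N → (∀ a → a ≢ a₀ → T (P a) → T (Q a)) → ¬ T (P a₀) → T (Q a₀) →
             1 ≤ a₀ → a₀ ≤ N → suc (count P N) ≤ count Q N
count-gain P Q a₀ zero    _   _   _   a₀≥1 a₀≤0 = ⊥-elim (<⇒≱ a₀≥1 a₀≤0)
count-gain P Q a₀ (suc N) P⇒Q ¬Pa₀ Qa₀ a₀≥1 a₀≤ with suc N ≟ a₀
... | no N+1≢a₀ = +-mono-≤ (count-gain P Q a₀ N P⇒Q ¬Pa₀ Qa₀ a₀≥1 a₀≤N) (bit-mono (P⇒Q (suc N) N+1≢a₀))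
  where
  a₀≤N : a₀ ≤ N
  a₀≤N = ≤-pred (≤∧≢⇒< a₀≤ (λ a₀≡ → N+1≢a₀ (sym a₀≡)))
... | yes refl  = begin
  suc (count P N + bit (P (suc N))) ≤⟨ s≤s (+-mono-≤ (count-mono-before P Q N P⇒Q) (bit-mono {b′ = false} ¬Pa₀)) ⟩
  suc (count Q N + 0)               ≡⟨ +-suc (count Q N) 0 ⟨
  count Q N + 1                     ≤⟨ +-monoʳ-≤ (count Q N) (bit-mono {b = true} (λ _ → Qa₀)) ⟩
  count Q N + bit (Q (suc N))       ∎
  where open ≤-Reasoning

count-positive : ∀ P {a} N → T (P a) → 1 ≤ a → a ≤ N → 1 ≤ count P N
count-positive P N Pa a≥1 a≤N = subst (λ c → suc c ≤ count P N) (count-none N)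
  (count-gain (λ _ → false) P _ N (λ _ _ ()) (λ ()) Pa a≥1 a≤N)

witness : ∀ P N → 1 ≤ count P N → ∃ λ a → a ≤ N × T (P a)
witness P (suc N) pos with P (suc N) in eq
... | true  = suc N , ≤-refl , subst T (sym eq) tt
... | false with witness P N (subst (1 ≤_) (+-identityʳ _) pos)
...   | a , a≤N , Pa = a , m≤n⇒m≤1+n a≤N , Pa

two-witnesses : ∀ P N → 2 ≤ count P N → ∃₂ λ a c → a < c × T (P a) × T (P c)
two-witnesses P (suc N) two with P (suc N) in eq
... | true with witness P N (≤-pred (subst (2 ≤_) (+-comm _ 1) two))
...   | a , a≤N , Pa = a , suc N , s≤s a≤N , Pa , subst T (sym eq) tt
two-witnesses P (suc N) two | false = two-witnesses P N (subst (2 ≤_) (+-identityʳ _) two)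

-- Addable and removable i-boxes, as boolean tests on rows (matching the lists addables and
-- removables of the definitions) and as propositions.

addableRow : List ℕ → ℕ → Bool
addableRow p a = (a ≡ᵇ 1) ∨ (row p a <ᵇ row p (a ∸ 1))

removableRow : List ℕ → ℕ → Bool
removableRow p a = row p (suc a) <ᵇ row p a

addableTest : ℕ → ℕ → List ℕ → ℕ → Bool
addableTest ℓ i p a = addableRow p a ∧ does (res ℓ a (suc (row p a)) ≟ i)

removableTest : ℕ → ℕ → List ℕ → ℕ → Bool
removableTest ℓ i p a = removableRow p a ∧ does (res ℓ a (row p a) ≟ i)

record Addable (ℓ i : ℕ) (p : List ℕ) (a : ℕ) : Set where
  field
    positive : 1 ≤ a
    corner   : 2 ≤ a → row p a < row p (a ∸ 1)
    residue  : res ℓ a (suc (row p a)) ≡ i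

record Removable (ℓ i : ℕ) (p : List ℕ) (a : ℕ) : Set where
  field
    corner  : row p (suc a) < row p a
    residue : res ℓ a (row p a) ≡ i

addable-sound : ∀ {ℓ i p} a → T (addableRow p a) → res ℓ a (suc (row p a)) ≡ i → Addable ℓ i p a
addable-sound {p = p} zero ok _ = ⊥-elim (<-irrefl refl (<ᵇ⇒< (row p 0) (row p 0) ok))
addable-sound (suc zero) _ r = record { positive = s≤s z≤n ; corner = λ { (s≤s ()) } ; residue = r }
addable-sound (suc (suc _)) ok r =
  record { positive = s≤s z≤n ; corner = λ _ → <ᵇ⇒< _ _ ok ; residue = r }

addable-complete : ∀ {ℓ i p a} → Addable ℓ i p a → T (addableTest ℓ i p a)
addable-complete {p = p} {a = a} A = Equivalence.from T-∧ (corner-ok {p} a positive corner , ≡⇒≡ᵇ _ _ residue)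
  where
  open Addable A
  corner-ok : ∀ {p} a → 1 ≤ a → (2 ≤ a → row p a < row p (a ∸ 1)) → T (addableRow p a)
  corner-ok (suc zero)    _ _      = tt
  corner-ok (suc (suc a)) _ corner = <⇒<ᵇ (corner (s≤s (s≤s z≤n)))

addableTest-sound : ∀ {ℓ i p} a → T (addableTest ℓ i p a) → Addable ℓ i p a
addableTest-sound a t = addable-sound a (proj₁ (Equivalence.to T-∧ t)) (≡ᵇ⇒≡ _ _ (proj₂ (Equivalence.to T-∧ t)))

removable-sound : ∀ {ℓ i p} a → T (removableRow p a) → res ℓ a (row p a) ≡ i → Removable ℓ i p a
removable-sound _ ok r = record { corner = <ᵇ⇒< _ _ ok ; residue = r }

removable-complete : ∀ {ℓ i p a} → Removable ℓ i p a → T (removableTest ℓ i p a)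
removable-complete R = Equivalence.from T-∧ (<⇒<ᵇ corner , ≡⇒≡ᵇ _ _ residue)
  where open Removable R

removableTest-sound : ∀ {ℓ i p} a → T (removableTest ℓ i p a) → Removable ℓ i p a
removableTest-sound a t = removable-sound a (proj₁ (Equivalence.to T-∧ t)) (≡ᵇ⇒≡ _ _ (proj₂ (Equivalence.to T-∧ t)))

removable-positive : ∀ {ℓ i p r} → Removable ℓ i p r → 1 ≤ r
removable-positive {p = p} {r = zero} R = ⊥-elim (n≮0 (subst (row p 1 <_) (row-zero p) (Removable.corner R)))
removable-positive {r = suc _} _ = s≤s z≤n

addable-range : ∀ {ℓ i p a} → Addable ℓ i p a → a ≤ suc (length p)
addable-range {p = p} {a = a} A = ≮⇒≥ (beyond a (Addable.corner A))
  where
  beyond : ∀ a → (2 ≤ a → row p a < row p (a ∸ 1)) → ¬ suc (length p) < a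
  beyond (suc (suc a)) corner (s≤s len<a+1) =
    <-irrefl (trans (row-beyond p (m<n⇒m<1+n len<a+1)) (sym (row-beyond p len<a+1))) (corner (s≤s (s≤s z≤n)))

removable-range : ∀ {ℓ i p a} → Removable ℓ i p a → a ≤ length p
removable-range {p = p} {a = a} R =
  ≮⇒≥ (λ len<a → n≮0 (subst (row p (suc a) <_) (row-beyond p len<a) (Removable.corner R)))

-- Numbers of addable and removable i-boxes: rows 1..len+1 may carry an addable box,
-- rows 1..len a removable one.
#addable : ℕ → ℕ → List ℕ → ℕ
#addable ℓ i p = count (addableTest ℓ i p) (suc (length p))

#removable : ℕ → ℕ → List ℕ → ℕ
#removable ℓ i p = count (removableTest ℓ i p) (length p)

-- the contributions of row a to the lists addables and removables
addableNodes : List ℕ → ℕ → List Node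
addableNodes p a = if addableRow p a then (plus , a , suc (row p a)) ∷ [] else []

removableNodes : List ℕ → ℕ → List Node
removableNodes p a = if removableRow p a then (minus , a , row p a) ∷ [] else []

atResidue : (ℓ i : ℕ) → Decidable (λ (n : Node) → res ℓ (proj₁ (proj₂ n)) (proj₂ (proj₂ n)) ≡ i)
atResidue ℓ i (_ , a , b) = res ℓ a b ≟ i

signBool : Sign → Bool
signBool plus  = true
signBool minus = false

sameSign : Sign → Sign → Bool
sameSign plus  plus  = true
sameSign minus minus = true
sameSign _     _     = false

-- #⟨ s ⟩ counts nodes of sign s; φ̂ and ε̂ are #⟨ plus ⟩ and #⟨ minus ⟩ of the reduced signature
hasSign : (s : Sign) → Decidable (λ n → isPlus n ≡ signBool s)
hasSign s n = isPlus n ≟ᵇ signBool s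

#⟨_⟩ : Sign → List Node → ℕ
#⟨ s ⟩ xs = length (filter (hasSign s) xs)

rows-suc : ∀ N → rows (suc N) ≡ rows N ++ suc N ∷ []
rows-suc N = trans (cong (map suc) (sym (upTo-∷ʳ N))) (map-++ suc (upTo N) (N ∷ []))

iCount : ℕ → ℕ → Sign → List Node → ℕ
iCount ℓ i s xs = #⟨ s ⟩ (filter (atResidue ℓ i) xs)

module _ {ℓ i : ℕ} (s : Sign) where

  iCount-++ : ∀ xs ys → iCount ℓ i s (xs ++ ys) ≡ iCount ℓ i s xs + iCount ℓ i s ys
  iCount-++ xs ys = begin
    length (filter (hasSign s) (filter R (xs ++ ys)))
      ≡⟨ cong (λ zs → length (filter (hasSign s) zs)) (filter-++ R xs ys) ⟩
    length (filter (hasSign s) (filter R xs ++ filter R ys))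
      ≡⟨ cong length (filter-++ (hasSign s) (filter R xs) (filter R ys)) ⟩
    length (filter (hasSign s) (filter R xs) ++ filter (hasSign s) (filter R ys))
      ≡⟨ length-++ (filter (hasSign s) (filter R xs)) ⟩
    iCount ℓ i s xs + iCount ℓ i s ys ∎
    where
    open ≡-Reasoning
    R : Decidable (λ (n : Node) → res ℓ (proj₁ (proj₂ n)) (proj₂ (proj₂ n)) ≡ i)
    R = atResidue ℓ i

  iCount-node : ∀ t c a b → iCount ℓ i s (if c then (t , a , b) ∷ [] else []) ≡
                bit (sameSign s t ∧ (c ∧ does (res ℓ a b ≟ i)))
  iCount-node t false a b rewrite ∧-zeroʳ (sameSign s t) = refl
  iCount-node t true  a b with res ℓ a b ≡ᵇ i
  ... | false rewrite ∧-zeroʳ (sameSign s t) = refl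
  ... | true  rewrite ∧-identityʳ (sameSign s t) = single s t
    where
    single : ∀ s t → #⟨ s ⟩ ((t , a , b) ∷ []) ≡ bit (sameSign s t)
    single plus  plus  = refl
    single plus  minus = refl
    single minus plus  = refl
    single minus minus = refl

  iCount-rows : (g : ℕ → List Node) (Q : ℕ → Bool) → (∀ a → iCount ℓ i s (g a) ≡ bit (Q a)) →
                ∀ N → iCount ℓ i s (concatMap g (rows N)) ≡ count Q N
  iCount-rows g Q per-row zero    = refl
  iCount-rows g Q per-row (suc N) = begin
    iCount ℓ i s (concatMap g (rows (suc N)))
      ≡⟨ cong (λ xs → iCount ℓ i s (concatMap g xs)) (rows-suc N) ⟩
    iCount ℓ i s (concatMap g (rows N ++ suc N ∷ []))
      ≡⟨ cong (iCount ℓ i s) (concatMap-++ g (rows N) (suc N ∷ [])) ⟩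
    iCount ℓ i s (concatMap g (rows N) ++ g (suc N) ++ [])
      ≡⟨ iCount-++ (concatMap g (rows N)) (g (suc N) ++ []) ⟩
    iCount ℓ i s (concatMap g (rows N)) + iCount ℓ i s (g (suc N) ++ [])
      ≡⟨ cong₂ _+_ (iCount-rows g Q per-row N) (trans (cong (iCount ℓ i s) (++-identityʳ (g (suc N)))) (per-row (suc N))) ⟩
    count Q N + bit (Q (suc N)) ∎
    where open ≡-Reasoning

  iNodes-count : ∀ p → #⟨ s ⟩ (iNodes ℓ i p) ≡
    count (λ a → sameSign s plus ∧ addableTest ℓ i p a) (suc (length p)) +
    count (λ a → sameSign s minus ∧ removableTest ℓ i p a) (length p)
  iNodes-count p = trans (iCount-++ (concatMap (addableNodes p) (rows (suc (length p)))) _)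
    (cong₂ _+_ (iCount-rows (addableNodes p) _ (λ a → iCount-node plus (addableRow p a) a (suc (row p a))) (suc (length p)))
               (iCount-rows (removableNodes p) _ (λ a → iCount-node minus (removableRow p a) a (row p a)) (length p)))

#⟨plus⟩-iNodes : ∀ ℓ i p → #⟨ plus ⟩ (iNodes ℓ i p) ≡ #addable ℓ i p
#⟨plus⟩-iNodes ℓ i p = begin
  #⟨ plus ⟩ (iNodes ℓ i p)                         ≡⟨ iNodes-count {ℓ} {i} plus p ⟩
  #addable ℓ i p + count (λ _ → false) (length p)  ≡⟨ cong (#addable ℓ i p +_) (count-none (length p)) ⟩
  #addable ℓ i p + 0                               ≡⟨ +-identityʳ _ ⟩
  #addable ℓ i p                                   ∎
  where open ≡-Reasoning

#⟨minus⟩-iNodes : ∀ ℓ i p → #⟨ minus ⟩ (iNodes ℓ i p) ≡ #removable ℓ i p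
#⟨minus⟩-iNodes ℓ i p = begin
  #⟨ minus ⟩ (iNodes ℓ i p)                                     ≡⟨ iNodes-count {ℓ} {i} minus p ⟩
  count (λ _ → false) (suc (length p)) + #removable ℓ i p       ≡⟨ cong (_+ #removable ℓ i p) (count-none (suc (length p))) ⟩
  #removable ℓ i p                                              ∎
  where open ≡-Reasoning

insert-↭ : ∀ ℓ n xs → insert ℓ n xs ↭ n ∷ xs
insert-↭ ℓ n []       = ↭.refl
insert-↭ ℓ n (m ∷ ms) with ladderLt ℓ n m
... | true  = ↭.refl
... | false = ↭.trans (↭.prep m (insert-↭ ℓ n ms)) (↭.swap m n ↭.refl)

signature-↭ : ∀ ℓ i p → signature ℓ i p ↭ iNodes ℓ i p
signature-↭ ℓ i p = sort-↭ (iNodes ℓ i p)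
  where
  sort-↭ : ∀ xs → sortLadder ℓ xs ↭ xs
  sort-↭ []       = ↭.refl
  sort-↭ (x ∷ xs) = ↭.trans (insert-↭ ℓ x (sortLadder ℓ xs)) (↭.prep x (sort-↭ xs))

step-⊆ : ∀ acc n → step acc n ⊆ n ∷ acc
step-⊆ []                   _           = ⊆-refl
step-⊆ ((plus , _) ∷ acc)   _           = ⊆-refl
step-⊆ ((minus , _) ∷ acc)  (plus , _)  = _ ∷ʳ (_ ∷ʳ ⊆-refl)
step-⊆ ((minus , _) ∷ acc)  (minus , _) = ⊆-refl

foldl-step-⊆ : ∀ acc xs → foldl step acc xs ⊆ xs ʳ++ acc
foldl-step-⊆ acc []       = ⊆-refl
foldl-step-⊆ acc (x ∷ xs) = ⊆-trans (foldl-step-⊆ (step acc x) xs) (ʳ++⁺ (⊆-refl {x = xs}) (step-⊆ acc x))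

-- reduced = reverse (foldl step [] signature), and reversing twice is the identity
reduced-⊆ : ∀ ℓ i p → reduced ℓ i p ⊆ signature ℓ i p
reduced-⊆ ℓ i p = subst (reduced ℓ i p ⊆_) (reverse-involutive (signature ℓ i p))
                        (reverse⁺ (foldl-step-⊆ [] (signature ℓ i p)))

reduced-count : ∀ ℓ i p s → #⟨ s ⟩ (reduced ℓ i p) ≤ #⟨ s ⟩ (iNodes ℓ i p)
reduced-count ℓ i p s = ≤-trans (length-mono-≤ (filter⁺ (hasSign s) (hasSign s) (λ { refl h → h }) (reduced-⊆ ℓ i p)))
                                (≤-reflexive (↭-length (filter-↭ (hasSign s) (signature-↭ ℓ i p))))

reduced-∈ : ∀ {ℓ i p n} → n ∈ reduced ℓ i p → n ∈ iNodes ℓ i p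
reduced-∈ {ℓ} {i} {p} n∈ = ∈-resp-↭ (signature-↭ ℓ i p) (lookup (reduced-⊆ ℓ i p) n∈)

φ̂≤#addable : ∀ ℓ i p → φ̂ ℓ i p ≤ #addable ℓ i p
φ̂≤#addable ℓ i p = ≤-trans (reduced-count ℓ i p plus) (≤-reflexive (#⟨plus⟩-iNodes ℓ i p))

ε̂≤#removable : ∀ ℓ i p → ε̂ ℓ i p ≤ #removable ℓ i p
ε̂≤#removable ℓ i p = ≤-trans (reduced-count ℓ i p minus) (≤-reflexive (#⟨minus⟩-iNodes ℓ i p))

∈-if : ∀ {n x : Node} c → n ∈ (if c then x ∷ [] else []) → T c × n ≡ x
∈-if true (here n≡x) = tt , n≡x

iNode-origin : ∀ {ℓ i p n} → n ∈ iNodes ℓ i p →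
  res ℓ (proj₁ (proj₂ n)) (proj₂ (proj₂ n)) ≡ i ×
  ((∃ λ a → T (addableRow p a) × n ≡ (plus , a , suc (row p a))) ⊎
   (∃ λ a → T (removableRow p a) × n ≡ (minus , a , row p a)))
iNode-origin {ℓ} {i} {p} n∈ with ∈-filter⁻ (atResidue ℓ i) n∈
... | n∈nodes , residue = residue ,
  ⊎-map (λ n∈add → let a , n∈row = satisfied (∈-concatMap⁻ (addableNodes p) {xs = rows (suc (length p))} n∈add)
                   in a , ∈-if (addableRow p a) n∈row)
        (λ n∈rem → let a , n∈row = satisfied (∈-concatMap⁻ (removableNodes p) {xs = rows (length p)} n∈rem)
                   in a , ∈-if (removableRow p a) n∈row)
        (∈-++⁻ (concatMap (addableNodes p) (rows (suc (length p)))) n∈nodes)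

plus-node-addable : ∀ {ℓ i p a b} → (plus , a , b) ∈ iNodes ℓ i p → Addable ℓ i p a
plus-node-addable {ℓ} {i} {p} n∈ with iNode-origin {ℓ} {i} {p} n∈
... | residue , inj₁ (a , ok , refl) = addable-sound a ok residue
... | _       , inj₂ (_ , _ , ())

minus-node-removable : ∀ {ℓ i p a b} → (minus , a , b) ∈ iNodes ℓ i p → Removable ℓ i p a
minus-node-removable {ℓ} {i} {p} n∈ with iNode-origin {ℓ} {i} {p} n∈
... | residue , inj₂ (a , ok , refl) = removable-sound a ok residue
... | _       , inj₁ (_ , _ , ())

lastM-∈ : ∀ {n : Node} xs → lastM xs ≡ just n → n ∈ xs
lastM-∈ (_ ∷ [])     refl = here refl
lastM-∈ (_ ∷ y ∷ ys) last   = there (lastM-∈ (y ∷ ys) last)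

firstM-∈ : ∀ {n : Node} xs → firstM xs ≡ just n → n ∈ xs
firstM-∈ (_ ∷ _) refl = here refl

f̂-adds-addable : ∀ ℓ i p {q} → f̂ ℓ i p ≡ just q → ∃ λ a → Addable ℓ i p a × q ≡ addAt p a
f̂-adds-addable ℓ i p f̂p≡q with lastM (conormals ℓ i p) in last
f̂-adds-addable ℓ i p refl | just (s , a , _)
  with ∈-filter⁻ (hasSign plus) {xs = reduced ℓ i p} (lastM-∈ (conormals ℓ i p) last)
... | n∈ , _ with s
...   | plus = a , plus-node-addable {ℓ} {i} {p} (reduced-∈ {ℓ} {i} {p} n∈) , refl

ê-removes-removable : ∀ ℓ i p {q} → ê ℓ i p ≡ just q → ∃ λ a → Removable ℓ i p a × q ≡ removeAt p a
ê-removes-removable ℓ i p êp≡q with firstM (normals ℓ i p) in first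
ê-removes-removable ℓ i p refl | just (s , a , _)
  with ∈-filter⁻ (hasSign minus) {xs = reduced ℓ i p} (firstM-∈ (normals ℓ i p) first)
... | n∈ , _ with s
...   | minus = a , minus-node-removable {ℓ} {i} {p} (reduced-∈ {ℓ} {i} {p} n∈) , refl

defined-not-JM : ∀ {ℓ r} → (∀ q → r ≡ just q → ¬ IsJM ℓ q) → ¬ IsJMᵐ ℓ r
defined-not-JM {r = just q} not-JM = not-JM q refl

<∸1⇒2+≤ : ∀ {k n} → k < n ∸ 1 → 2 + k ≤ n
<∸1⇒2+≤ {n = suc _} k<n = s≤s k<n

-- From here on ℓ = m + 2 ≥ 2, so that res ℓ a b = (b + (m + 1) a) mod ℓ is the content b - a mod ℓ
-- and neighbouring positions have different residues.
module Ladder (m : ℕ) where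

  ℓ : ℕ
  ℓ = 2 + m

  ℓ∤1 : ¬ ℓ ∣ 1
  ℓ∤1 ℓ∣1 with ∣1⇒≡1 ℓ∣1
  ... | ()

  ℓ∤ℓ-1 : ¬ ℓ ∣ suc m
  ℓ∤ℓ-1 ℓ∣ℓ-1 = n≮n (suc m) (∣⇒≤ ℓ∣ℓ-1)

  res-right≢ : ∀ a b → res ℓ a (suc b) ≢ res ℓ a b
  res-right≢ a b same = ℓ∤1 (congruent⇒∣ 1 (suc b + suc m * a) (b + suc m * a) 0 (balance b a m) same)
    where
    balance : ∀ b a m → 1 + (b + suc m * a) ≡ (suc b + suc m * a) + (2 + m) * 0
    balance = solve-∀

  res-down≢ : ∀ a b → res ℓ (suc a) b ≢ res ℓ a b
  res-down≢ a b same = ℓ∤ℓ-1 (congruent⇒∣ (suc m) (b + suc m * suc a) (b + suc m * a) 0 (balance b a m) same)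
    where
    balance : ∀ b a m → suc m + (b + suc m * a) ≡ (b + suc m * suc a) + (2 + m) * 0
    balance = solve-∀

  -- Hook lengths through residues: for a box (a,b) whose row ends in column R and whose
  -- column ends in row C, ℓ divides the hook (R - b) + 1 + (C - a) exactly when the position
  -- right of the row end has the residue of the column end, or equivalently when the row
  -- end has the residue of the position below the column end.
  module _ {a b R C : ℕ} (b≤R : b ≤ R) (a≤C : a ≤ C) where

    private
      h : ℕ
      h = (R ∸ b) + 1 + (C ∸ a)
      identity₁ : ∀ b e a g m → (e + 1 + g) + (b + suc m * (a + g)) ≡ (suc (b + e) + suc m * a) + (2 + m) * g
      identity₁ = solve-∀
      identity₂ : ∀ b e a g m → (e + 1 + g) + (b + suc m * suc (a + g)) ≡ ((b + e) + suc m * a) + (2 + m) * suc g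
      identity₂ = solve-∀
      X₁ Y₁ X₂ Y₂ : ℕ
      X₁ = suc R + suc m * a
      Y₁ = b + suc m * C
      X₂ = R + suc m * a
      Y₂ = b + suc m * suc C
      balance₁ : h + Y₁ ≡ X₁ + ℓ * (C ∸ a)
      balance₁ = subst₂ (λ R′ C′ → h + (b + suc m * C′) ≡ (suc R′ + suc m * a) + ℓ * (C ∸ a))
                        (m+[n∸m]≡n b≤R) (m+[n∸m]≡n a≤C) (identity₁ b (R ∸ b) a (C ∸ a) m)
      balance₂ : h + Y₂ ≡ X₂ + ℓ * suc (C ∸ a)
      balance₂ = subst₂ (λ R′ C′ → h + (b + suc m * suc C′) ≡ (R′ + suc m * a) + ℓ * suc (C ∸ a))
                        (m+[n∸m]≡n b≤R) (m+[n∸m]≡n a≤C) (identity₂ b (R ∸ b) a (C ∸ a) m)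

    hook-criterion : ℓ ∣ (R ∸ b) + 1 + (C ∸ a) ⇔ res ℓ a (suc R) ≡ res ℓ C b
    hook-criterion = mk⇔ (∣⇒congruent h X₁ Y₁ (C ∸ a) balance₁) (congruent⇒∣ h X₁ Y₁ (C ∸ a) balance₁)

    hook-criterion′ : ℓ ∣ (R ∸ b) + 1 + (C ∸ a) ⇔ res ℓ a R ≡ res ℓ (suc C) b
    hook-criterion′ = mk⇔ (∣⇒congruent h X₂ Y₂ (suc (C ∸ a)) balance₂) (congruent⇒∣ h X₂ Y₂ (suc (C ∸ a)) balance₂)

  module Obstruction {i : ℕ} {p : List ℕ} {c₁ c₂′ r : ℕ} (part : IsPartition p)
    (A₁ : Addable ℓ i p c₁) (A₂ : Addable ℓ i p (suc c₂′)) (c₁≤c₂′ : c₁ ≤ c₂′)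
    (Rm : Removable ℓ i p r) where

    private
      module A₁ = Addable A₁
      module A₂ = Addable A₂
      module Rm = Removable Rm
      decreasing : Linked _≥_ p
      decreasing = proj₁ part
      u₁ u₂ s : ℕ
      u₁ = row p c₁
      u₂ = row p (suc c₂′)
      s  = row p r

      r≥1 : 1 ≤ r
      r≥1 = removable-positive Rm
      s≥1 : 1 ≤ s
      s≥1 = ≤-trans (s≤s z≤n) Rm.corner
      u₂<row-c₂′ : u₂ < row p c₂′
      u₂<row-c₂′ = A₂.corner (s≤s (≤-trans A₁.positive c₁≤c₂′))
      u₂<u₁ : u₂ < u₁
      u₂<u₁ = ≤-trans u₂<row-c₂′ (row-antitone decreasing A₁.positive c₁≤c₂′)

      column-u₂+1 : colLen p (suc u₂) ≡ c₂′
      column-u₂+1 = colLen-exact c₂′ decreasing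
        (λ a a≥1 a≤c₂′ → ≤-trans u₂<row-c₂′ (row-antitone decreasing a≥1 a≤c₂′)) (n<1+n u₂)
      column-s : colLen p s ≡ r
      column-s = colLen-exact r decreasing (λ a a≥1 a≤r → row-antitone decreasing a≥1 a≤r) Rm.corner

      below-column-u₂+1 : ∀ {a} → a ≤ c₂′ → a ≤ colLen p (suc u₂)
      below-column-u₂+1 a≤ = subst (_ ≤_) (sym column-u₂+1) a≤
      below-column-s : ∀ {a} → a ≤ r → a ≤ colLen p s
      below-column-s a≤ = subst (_ ≤_) (sym column-s) a≤

    -- (c₁, u₂+1): the position right of row c₁ has residue i, the column end lies just above
    -- the addable i-box of row c₂′+1.
    hook-c₁-u₂ : ¬ ℓ ∣ hook p c₁ (suc u₂)
    hook-c₁-u₂ ℓ∣h = res-down≢ c₂′ (suc u₂) (begin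
      res ℓ (suc c₂′) (suc u₂)             ≡⟨ trans A₂.residue (sym A₁.residue) ⟩
      res ℓ c₁ (suc u₁)                    ≡⟨ Equivalence.to (hook-criterion u₂<u₁ (below-column-u₂+1 c₁≤c₂′)) ℓ∣h ⟩
      res ℓ (colLen p (suc u₂)) (suc u₂)   ≡⟨ cong (λ C → res ℓ C (suc u₂)) column-u₂+1 ⟩
      res ℓ c₂′ (suc u₂)                   ∎)
      where open ≡-Reasoning

    -- (r, s) is the removable box itself, whose hook is 1.
    hook-r-s : ¬ ℓ ∣ hook p r s
    hook-r-s ℓ∣h = res-right≢ r s (trans (Equivalence.to (hook-criterion {r} {s} {s} ≤-refl (below-column-s ≤-refl)) ℓ∣h)
                                         (cong (λ C → res ℓ C s) column-s))

    violation-above : c₁ < r → ¬ IsJM ℓ p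
    violation-above c₁<r jm = jm (c₁ , s , suc u₂ , r ,
      (A₁.positive , s≥1 , s≤u₁) , (A₁.positive , s≤s z≤n , u₂<u₁) , (r≥1 , s≥1 , ≤-refl) ,
      hook-c₁-s , hook-c₁-u₂ , hook-r-s)
      where
      s≤u₁ : s ≤ u₁
      s≤u₁ = row-antitone decreasing A₁.positive (<⇒≤ c₁<r)
      hook-c₁-s : ℓ ∣ hook p c₁ s
      hook-c₁-s = Equivalence.from (hook-criterion s≤u₁ (below-column-s (<⇒≤ c₁<r)))
        (trans A₁.residue (trans (sym Rm.residue) (cong (λ C → res ℓ C s) (sym column-s))))

    violation-below : r < c₁ → ¬ IsJM ℓ p
    violation-below r<c₁ jm = jm (r , suc u₂ , s , c₁ ,
      (r≥1 , s≤s z≤n , u₂<s) , (r≥1 , s≥1 , ≤-refl) , (A₁.positive , s≤s z≤n , u₂<u₁) ,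
      hook-r-u₂ , hook-r-s , hook-c₁-u₂)
      where
      r≤c₂′ : r ≤ c₂′
      r≤c₂′ = ≤-trans (<⇒≤ r<c₁) c₁≤c₂′
      u₂<s : u₂ < s
      u₂<s = ≤-<-trans (row-antitone decreasing (s≤s z≤n) (s≤s r≤c₂′)) Rm.corner
      hook-r-u₂ : ℓ ∣ hook p r (suc u₂)
      hook-r-u₂ = Equivalence.from (hook-criterion′ u₂<s (below-column-u₂+1 r≤c₂′))
        (trans Rm.residue (trans (sym A₂.residue) (cong (λ C → res ℓ (suc C) (suc u₂)) (sym column-u₂+1))))

    same-row : c₁ ≢ r
    same-row c₁≡r = res-right≢ r s (trans (subst (λ c → res ℓ c (suc (row p c)) ≡ i) c₁≡r A₁.residue)
                                          (sym Rm.residue))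

  two-addable-one-removable : ∀ {i p c₁ c₂ r} → IsPartition p → Addable ℓ i p c₁ → Addable ℓ i p c₂ →
                              c₁ < c₂ → Removable ℓ i p r → ¬ IsJM ℓ p
  two-addable-one-removable {c₁ = c₁} {r = r} part A₁ A₂ (s≤s c₁≤c₂′) Rm with <-cmp c₁ r
  ... | tri< c₁<r _ _ = Obstruction.violation-above part A₁ A₂ c₁≤c₂′ Rm c₁<r
  ... | tri≈ _ c₁≡r _ = ⊥-elim (Obstruction.same-row part A₁ A₂ c₁≤c₂′ Rm c₁≡r)
  ... | tri> _ _ r<c₁ = Obstruction.violation-below part A₁ A₂ c₁≤c₂′ Rm r<c₁

  module AddStep {i : ℕ} {p : List ℕ} {a₀ : ℕ} (part : IsPartition p) (A₀ : Addable ℓ i p a₀) where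

    private
      module A₀ = Addable A₀
      q : List ℕ
      q = addAt p a₀
      in-range : a₀ ≤ suc (length p)
      in-range = addable-range A₀
      row-a₀ : row q a₀ ≡ suc (row p a₀)
      row-a₀ = row-addAt-here p A₀.positive in-range
      elsewhere : ∀ a → a ≢ a₀ → row q a ≡ row p a
      elsewhere a = row-addAt-elsewhere p a A₀.positive in-range

    partition : IsPartition q
    partition = addAt-partition p part A₀.positive in-range A₀.corner

    removable-here : Removable ℓ i q a₀
    removable-here = record
      { corner  = subst₂ _<_ (sym (elsewhere (suc a₀) (λ eq → <-irrefl (sym eq) (n<1+n a₀)))) (sym row-a₀)
                         (s≤s (row-antitone (proj₁ part) A₀.positive (n≤1+n a₀)))
      ; residue = subst (λ b → res ℓ a₀ b ≡ i) (sym row-a₀) A₀.residue }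

    keeps-addable : ∀ a → a ≢ a₀ → Addable ℓ i p a → Addable ℓ i q a
    keeps-addable a a≢a₀ A = record
      { positive = A.positive
      ; corner   = λ a≥2 → subst (_< row q (a ∸ 1)) (sym (elsewhere a a≢a₀)) (corner′ a≥2)
      ; residue  = subst (λ u → res ℓ a (suc u) ≡ i) (sym (elsewhere a a≢a₀)) A.residue }
      where
      module A = Addable A
      corner′ : 2 ≤ a → row p a < row q (a ∸ 1)
      corner′ a≥2 with a ∸ 1 ≟ a₀
      ... | no  a-1≢a₀ = subst (row p a <_) (sym (elsewhere (a ∸ 1) a-1≢a₀)) (A.corner a≥2)
      ... | yes a-1≡a₀ = subst (row p a <_) (sym (trans (cong (row q) a-1≡a₀) (trans row-a₀ (cong (suc ∘ row p) (sym a-1≡a₀)))))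
                               (m<n⇒m<1+n (A.corner a≥2))

  module RemoveStep {i : ℕ} {p : List ℕ} {a₀ : ℕ} (part : IsPartition p) (R₀ : Removable ℓ i p a₀) where

    private
      module R₀ = Removable R₀
      decreasing : Linked _≥_ p
      decreasing = proj₁ part
      q : List ℕ
      q = removeAt p a₀
      s : ℕ
      s = row p a₀
      a₀≥1 : 1 ≤ a₀
      a₀≥1 = removable-positive R₀
      s-1+1 : suc (s ∸ 1) ≡ s
      s-1+1 = m+[n∸m]≡n (≤-trans (s≤s z≤n) R₀.corner)
      row-a₀ : row q a₀ ≡ s ∸ 1
      row-a₀ = row-removeAt-here p (proj₂ part) R₀.corner
      elsewhere : ∀ a → a ≢ a₀ → row q a ≡ row p a
      elsewhere a = row-removeAt-elsewhere p a (proj₂ part) R₀.corner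

    partition : IsPartition q
    partition = removeAt-partition p part R₀.corner

    addable-here : Addable ℓ i q a₀
    addable-here = record
      { positive = a₀≥1
      ; corner   = corner′
      ; residue  = subst (λ b → res ℓ a₀ b ≡ i) (sym (trans (cong suc row-a₀) s-1+1)) R₀.residue }
      where
      corner′ : 2 ≤ a₀ → row q a₀ < row q (a₀ ∸ 1)
      corner′ a₀≥2 = subst₂ _<_ (sym row-a₀) (sym (elsewhere (a₀ ∸ 1) (proj₂ (previous-row a₀≥2))))
        (≤-trans (≤-reflexive s-1+1) (row-antitone decreasing (proj₁ (previous-row a₀≥2)) (m∸n≤m a₀ 1)))

    -- ... which was not addable before, the removed box having residue i
    not-addable-before : ¬ Addable ℓ i p a₀
    not-addable-before A = res-right≢ a₀ s (trans (Addable.residue A) (sym R₀.residue))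

    -- all other addable i-boxes survive; the one in row a₀+1 cannot sit directly below the
    -- removed box, since vertically adjacent positions have different residues
    keeps-addable : ∀ a → a ≢ a₀ → Addable ℓ i p a → Addable ℓ i q a
    keeps-addable zero    _      A = ⊥-elim (n≮0 (Addable.positive A))
    keeps-addable (suc a) a+1≢a₀ A = record
      { positive = A.positive
      ; corner   = λ a+1≥2 → subst (_< row q a) (sym (elsewhere (suc a) a+1≢a₀)) (corner′ a+1≥2)
      ; residue  = subst (λ u → res ℓ (suc a) (suc u) ≡ i) (sym (elsewhere (suc a) a+1≢a₀)) A.residue }
      where
      module A = Addable A
      corner′ : 2 ≤ suc a → row p (suc a) < row q a
      corner′ a+1≥2 with a ≟ a₀
      ... | no a≢a₀  = subst (row p (suc a) <_) (sym (elsewhere a a≢a₀)) (A.corner a+1≥2)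
      ... | yes refl = subst (row p (suc a₀) <_) (sym row-a₀) (≤∧≢⇒< below-s-1 not-directly-below)
        where
        below-s-1 : row p (suc a₀) ≤ s ∸ 1
        below-s-1 = ≤-pred (subst (row p (suc a₀) <_) (sym s-1+1) R₀.corner)
        not-directly-below : row p (suc a₀) ≢ s ∸ 1
        not-directly-below eq = res-down≢ a₀ s
          (trans (subst (λ u → res ℓ (suc a₀) u ≡ i) (trans (cong suc eq) s-1+1) A.residue) (sym R₀.residue))

    keeps-removable : ∀ a → a ≢ a₀ → Removable ℓ i p a → Removable ℓ i q a
    keeps-removable a a≢a₀ R = record
      { corner  = subst (row q (suc a) <_) (sym (elsewhere a a≢a₀)) corner′
      ; residue = subst (λ u → res ℓ a u ≡ i) (sym (elsewhere a a≢a₀)) R.residue }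
      where
      module R = Removable R
      corner′ : row q (suc a) < row p a
      corner′ with suc a ≟ a₀
      ... | no a+1≢a₀ = subst (_< row p a) (sym (elsewhere (suc a) a+1≢a₀)) R.corner
      ... | yes refl  = subst (_< row p a) (sym row-a₀) (≤-<-trans (m∸n≤m s 1) R.corner)

  add-step-counts : ∀ {i p a₀} → IsPartition p → Addable ℓ i p a₀ →
    #addable ℓ i p ≤ suc (#addable ℓ i (addAt p a₀)) × 1 ≤ #removable ℓ i (addAt p a₀)
  add-step-counts {i} {p} {a₀} part A₀ = lost , gained
    where
    open AddStep part A₀
    q : List ℕ
    q = addAt p a₀
    lost : #addable ℓ i p ≤ suc (#addable ℓ i q)
    lost = ≤-trans (count-except (addableTest ℓ i p) (addableTest ℓ i q) a₀ (suc (length p))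
                     (λ a a≢a₀ t → addable-complete (keeps-addable a a≢a₀ (addableTest-sound a t))))
                   (s≤s (count-mono-range (addableTest ℓ i q) (s≤s (length-addAt p a₀))))
    gained : 1 ≤ #removable ℓ i q
    gained = count-positive (removableTest ℓ i q) (length q) (removable-complete removable-here)
               (Addable.positive A₀) (removable-range removable-here)

  remove-step-counts : ∀ {i p a₀} → IsPartition p → Removable ℓ i p a₀ →
    suc (#addable ℓ i p) ≤ #addable ℓ i (removeAt p a₀) × #removable ℓ i p ≤ suc (#removable ℓ i (removeAt p a₀))
  remove-step-counts {i} {p} {a₀} part R₀ = gained , lost
    where
    open RemoveStep part R₀
    q : List ℕ
    q = removeAt p a₀
    shorter : length q ≤ length p
    shorter = length-removeAt p a₀
    gained : suc (#addable ℓ i p) ≤ #addable ℓ i q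
    gained = ≤-trans
      (count-gain (addableTest ℓ i p) (addableTest ℓ i q) a₀ (suc (length p))
        (λ a a≢a₀ t → addable-complete (keeps-addable a a≢a₀ (addableTest-sound a t)))
        (λ t → not-addable-before (addableTest-sound a₀ t)) (addable-complete addable-here)
        (removable-positive R₀) (m≤n⇒m≤1+n (removable-range R₀)))
      (≤-reflexive (count-stable (addableTest ℓ i q)
        (λ a far t → <⇒≱ far (addable-range (addableTest-sound {ℓ} {i} {q} a t))) (s≤s shorter)))
    lost : #removable ℓ i p ≤ suc (#removable ℓ i q)
    lost = ≤-trans
      (count-except (removableTest ℓ i p) (removableTest ℓ i q) a₀ (length p)
        (λ a a≢a₀ t → removable-complete (keeps-removable a a≢a₀ (removableTest-sound a t))))
      (s≤s (≤-reflexive (count-stable (removableTest ℓ i q)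
        (λ a far t → <⇒≱ far (removable-range (removableTest-sound {ℓ} {i} {q} a t))) shorter)))

  iterate-f̂ : ∀ {i p} → IsPartition p → ∀ k {q} → iter (f̂ ℓ i) k p ≡ just q →
    IsPartition q × #addable ℓ i p ≤ #addable ℓ i q + k × (1 ≤ k → 1 ≤ #removable ℓ i q)
  iterate-f̂ part zero refl = part , m≤m+n _ 0 , λ ()
  iterate-f̂ {i} {p} part (suc k) f̂ᵏ⁺¹p≡q with iter (f̂ ℓ i) k p in f̂ᵏp≡μ
  ... | just μ with iterate-f̂ part k f̂ᵏp≡μ | f̂-adds-addable ℓ i μ f̂ᵏ⁺¹p≡q
  ...   | part-μ , bound , _ | a₀ , A₀ , refl with add-step-counts part-μ A₀
  ...     | lost , gained = AddStep.partition part-μ A₀ , bound′ , λ _ → gained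
    where
    open ≤-Reasoning
    bound′ : #addable ℓ i p ≤ #addable ℓ i (addAt μ a₀) + suc k
    bound′ = begin
      #addable ℓ i p                       ≤⟨ bound ⟩
      #addable ℓ i μ + k                   ≤⟨ +-monoˡ-≤ k lost ⟩
      suc (#addable ℓ i (addAt μ a₀)) + k  ≡⟨ +-suc _ k ⟨
      #addable ℓ i (addAt μ a₀) + suc k    ∎

  iterate-ê : ∀ {i p} → IsPartition p → ∀ k {q} → iter (ê ℓ i) k p ≡ just q →
    IsPartition q × #addable ℓ i p + k ≤ #addable ℓ i q × #removable ℓ i p ≤ #removable ℓ i q + k
  iterate-ê part zero refl = part , ≤-reflexive (+-identityʳ _) , m≤m+n _ 0
  iterate-ê {i} {p} part (suc k) êᵏ⁺¹p≡q with iter (ê ℓ i) k p in êᵏp≡μ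
  ... | just μ with iterate-ê part k êᵏp≡μ | ê-removes-removable ℓ i μ êᵏ⁺¹p≡q
  ...   | part-μ , gain , loss | a₀ , R₀ , refl with remove-step-counts part-μ R₀
  ...     | gained , lost = RemoveStep.partition part-μ R₀ , gain′ , loss′
    where
    open ≤-Reasoning
    gain′ : #addable ℓ i p + suc k ≤ #addable ℓ i (removeAt μ a₀)
    gain′ = begin
      #addable ℓ i p + suc k            ≡⟨ +-suc _ k ⟩
      suc (#addable ℓ i p + k)          ≤⟨ s≤s gain ⟩
      suc (#addable ℓ i μ)              ≤⟨ gained ⟩
      #addable ℓ i (removeAt μ a₀)      ∎
    loss′ : #removable ℓ i p ≤ #removable ℓ i (removeAt μ a₀) + suc k
    loss′ = begin
      #removable ℓ i p                          ≤⟨ loss ⟩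
      #removable ℓ i μ + k                      ≤⟨ +-monoˡ-≤ k lost ⟩
      suc (#removable ℓ i (removeAt μ a₀)) + k  ≡⟨ +-suc _ k ⟨
      #removable ℓ i (removeAt μ a₀) + suc k    ∎

  not-JM-by-count : ∀ {i q} → IsPartition q → 2 ≤ #addable ℓ i q → 1 ≤ #removable ℓ i q → ¬ IsJM ℓ q
  not-JM-by-count {i} {q} part two one
    with two-witnesses (addableTest ℓ i q) (suc (length q)) two | witness (removableTest ℓ i q) (length q) one
  ... | c₁ , c₂ , c₁<c₂ , t₁ , t₂ | r , _ , t =
    two-addable-one-removable part (addableTest-sound c₁ t₁) (addableTest-sound c₂ t₂) c₁<c₂
                                   (removableTest-sound r t)

  f̂-powers-not-JM : ∀ {i p} → IsPartition p →
    ∀ k → 0 < k → k < φ̂ ℓ i p ∸ 1 → ¬ IsJMᵐ ℓ (iter (f̂ ℓ i) k p)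
  f̂-powers-not-JM {i} {p} part k k>0 k<φ̂-1 = defined-not-JM λ q f̂ᵏp≡q →
    let part-q , bound , removable = iterate-f̂ part k f̂ᵏp≡q in
    not-JM-by-count part-q
      (+-cancelʳ-≤ k 2 _ (≤-trans (<∸1⇒2+≤ k<φ̂-1) (≤-trans (φ̂≤#addable ℓ i p) bound)))
      (removable k>0)

  ê-powers-not-JM : ∀ {i p} → IsPartition p →
    ∀ k → 1 < k → k < ε̂ ℓ i p → ¬ IsJMᵐ ℓ (iter (ê ℓ i) k p)
  ê-powers-not-JM {i} {p} part k k>1 k<ε̂ = defined-not-JM λ q êᵏp≡q →
    let part-q , gain , loss = iterate-ê part k êᵏp≡q in
    not-JM-by-count part-q
      (≤-trans k>1 (≤-trans (m≤n+m k _) gain))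
      (+-cancelʳ-≤ k 1 _ (≤-trans k<ε̂ (≤-trans (ε̂≤#removable ℓ i p) loss)))

-- The theorem itself: ℓ ≥ 3 is of the form m + 2.
theorem8p6 : (ℓ : ℕ) → 3 ≤ ℓ → (p : List ℕ) → IsPartition p → IsJM ℓ p →
    (i : ℕ) → i < ℓ →
    ((k : ℕ) → 0 < k → k < φ̂ ℓ i p ∸ 1 → ¬ IsJMᵐ ℓ (iter (f̂ ℓ i) k p))
    × ((k : ℕ) → 1 < k → k < ε̂ ℓ i p → ¬ IsJMᵐ ℓ (iter (ê ℓ i) k p))
theorem8p6 _ (s≤s (s≤s (s≤s (z≤n {n})))) _ part _ _ _ =
  Ladder.f̂-powers-not-JM (suc n) part , Ladder.ê-powers-not-JM (suc n) part
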